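{- The languages $Equal=\{x\in\{0,1\}^*\mid \#_0(x)=\#_1(x)\}$ and $Pal=\{ww^R\mid w\in\{0,1\}^*\}$ are both $\mathrm{REG}$-levelable.
   Context: $\#_a(x)$ is the number of occurrences of the symbol $a$ in $x$, and $w^R$ is the reversal of $w$. A language is $\mathrm{REG}$-immune if it is infinite and has no infinite regular subset. A language $L$ is almost $\mathrm{REG}$-immune if $L=C\cup D$ for some $\mathrm{REG}$-immune set $C$ and some regular set $D$. An infinite language is $\mathrm{REG}$-levelable if it is not almost $\mathrm{REG}$-immune. -}

module Defs where

open import Data.Bool using (Bool; true; false)
open import Data.Nat using (ℕ; zero; suc)
open import Data.Fin using (Fin)
open import Data.List using (List; []; _∷_; _++_; reverse)
open import Data.List.Membership.Propositional using (_∈_)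
open import Data.Product using (Σ; _×_)
open import Data.Sum using (_⊎_)
open import Relation.Binary.PropositionalEquality using (_≡_)
open import Relation.Nullary using (¬_)
open import Function.Bundles using (_⇔_)

-- Alphabet {0,1}: the symbol 0 is false, the symbol 1 is true.
Word : Set
Word = List Bool

Language : Set₁
Language = Word → Set

count : Bool → Word → ℕ
count a [] = zero
count true (true ∷ x) = suc (count true x)
count true (false ∷ x) = count true x
count false (false ∷ x) = suc (count false x)
count false (true ∷ x) = count false x

record DFA (n : ℕ) : Set where
  field
    δ      : Fin n → Bool → Fin n
    start  : Fin n
    accept : Fin n → Bool

run : ∀ {n} → DFA n → Fin n → Word → Fin n
run M q [] = q
run M q (a ∷ w) = run M (DFA.δ M q a) w

accepts : ∀ {n} → DFA n → Word → Bool
accepts M w = DFA.accept M (run M (DFA.start M) w)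

Regular : Language → Set
Regular L = Σ ℕ λ n → Σ (DFA n) λ M → ∀ w → (L w ⇔ (accepts M w ≡ true))

Finite : Language → Set
Finite L = Σ (List Word) λ xs → ∀ w → L w → w ∈ xs

Infinite : Language → Set
Infinite L = ¬ Finite L

_⊆_ : Language → Language → Set
S ⊆ C = ∀ w → S w → C w

REG-immune : Language → Set₁
REG-immune C = Infinite C × (∀ (S : Language) → S ⊆ C → Regular S → ¬ Infinite S)

AlmostREG-immune : Language → Set₁
AlmostREG-immune L = Σ Language λ C → Σ Language λ D →
  REG-immune C × Regular D × (∀ w → (L w ⇔ (C w ⊎ D w)))

REG-levelable : Language → Set₁
REG-levelable L = Infinite L × ¬ AlmostREG-immune L

Equal : Language
Equal x = count false x ≡ count true x

Pal : Language
Pal x = Σ Word λ w → x ≡ w ++ reverse w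

-- Let D ⊆ L be regular, accepted by a DFA with n states. Among the words 0^0, …, 0^n two, 0^a and 0^b
-- with a < b, lead to the same state, so the DFA treats 0^a v and 0^b v alike. We exhibit an infinite
-- regular family of words 0^b v ∈ L such that 0^a v ∉ L: the DFA rejects 0^a v, hence 0^b v ∉ D. So
-- L ∖ D has an infinite regular subset, and L cannot be the union of D with a REG-immune set. For
-- Equal the family is 0^b (01)^m 1^b, for Pal it is 0^b 1^(2m+2) 0^b.
module Submission where

open import Defs
open import Data.Bool using (Bool; true; false; not)
open import Data.Bool.Properties using (¬-not) renaming (_≟_ to _≟ᵇ_)
open import Data.Empty using (⊥-elim)
open import Data.Fin using (Fin; zero; suc; fromℕ; inject₁; toℕ)
open import Data.Fin.Properties using (+↔⊎; pigeonhole)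
open import Data.List using ([]; _∷_; _++_; [_]; replicate; reverse; length; map)
open import Data.List.Extrema.Nat using (max; xs≤max)
open import Data.List.Membership.Propositional.Properties using (∈-map⁺)
open import Data.List.Properties
  using (++-assoc; ++-identityʳ; reverse-++; reverse-involutive; length-++-≤ˡ; length-++-≤ʳ)
open import Data.List.Relation.Unary.All using (lookup)
open import Data.Maybe using (Maybe; just; nothing; maybe; _>>=_)
open import Data.Nat using (ℕ; zero; suc; _+_; _≤_; z≤n; s≤s; s≤s⁻¹)
open import Data.Nat.Properties
  using (≤-trans; n<1+n; n≤1+n; n≮n; m≤n⇒m≤1+n; m≤m+n; <⇒≢; +-comm; +-suc; +-identityʳ; +-cancelʳ-≡)
open import Data.Product using (Σ; ∃; ∃₂; _×_; _,_)
open import Data.Sum using (_⊎_; inj₁; inj₂)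
open import Data.Sum.Function.Propositional using (_⊎-↔_)
open import Function using (_∘_)
open import Function.Bundles using (_↔_; _⇔_; mk⇔; Inverse; Equivalence)
open import Function.Properties.Inverse using (↔-refl; ↔-sym; ↔-trans)
open import Relation.Binary.PropositionalEquality
  using (_≡_; refl; sym; trans; cong; cong₂; subst; module ≡-Reasoning)
open import Relation.Nullary using (¬_; yes; no)
open ≡-Reasoning

zeros ones : ℕ → Word
zeros k = replicate k false
ones k = replicate k true

replicate-+ : ∀ {A : Set} m n (x : A) → replicate (m + n) x ≡ replicate m x ++ replicate n x
replicate-+ zero n x = refl
replicate-+ (suc m) n x = cong (x ∷_) (replicate-+ m n x)

reverse-replicate : ∀ {A : Set} n (x : A) → reverse (replicate n x) ≡ replicate n x
reverse-replicate zero x = refl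
reverse-replicate (suc n) x = begin
  reverse ([ x ] ++ replicate n x)       ≡⟨ reverse-++ [ x ] (replicate n x) ⟩
  reverse (replicate n x) ++ [ x ]      ≡⟨ cong (_++ [ x ]) (reverse-replicate n x) ⟩
  replicate n x ++ replicate 1 x        ≡⟨ replicate-+ n 1 x ⟨
  replicate (n + 1) x                   ≡⟨ cong (λ k → replicate k x) (+-comm n 1) ⟩
  replicate (suc n) x                   ∎

length-replicate-++ : ∀ {A : Set} k (x : A) ys → k ≤ length (replicate k x ++ ys)
length-replicate-++ zero    x ys = z≤n
length-replicate-++ (suc k) x ys = s≤s (length-replicate-++ k x ys)

Range : (ℕ → Word) → Language
Range f w = ∃ λ m → w ≡ f m

_∩_ : Language → Language → Language
(L ∩ K) w = L w × K w

unbounded⇒infinite : (f : ℕ → Word) → (∀ m → m ≤ length (f m)) → Infinite (Range f)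
unbounded⇒infinite f long (ws , complete) = n≮n bound (≤-trans (long (suc bound)) f[1+bound]≤bound)
  where
  bound : ℕ
  bound = max 0 (map length ws)
  f[1+bound]≤bound : length (f (suc bound)) ≤ bound
  f[1+bound]≤bound = lookup (xs≤max 0 (map length ws)) (∈-map⁺ length (complete _ (suc bound , refl)))

infinite-⊆ : {S L : Language} → S ⊆ L → Infinite S → Infinite L
infinite-⊆ S⊆L S-infinite (ws , complete) = S-infinite (ws , λ w → complete w ∘ S⊆L w)

Accepted Rejected : ∀ {n} → DFA n → Language
Accepted M w = accepts M w ≡ true
Rejected M w = accepts M w ≡ false

run-++ : ∀ {n} (M : DFA n) q u v → run M q (u ++ v) ≡ run M (run M q u) v
run-++ M q [] v = refl
run-++ M q (a ∷ u) v = run-++ M (DFA.δ M q a) u v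

accepts-++-cong : ∀ {n} (M : DFA n) u u′ v → run M (DFA.start M) u ≡ run M (DFA.start M) u′ →
  accepts M (u ++ v) ≡ accepts M (u′ ++ v)
accepts-++-cong M u u′ v same = cong (DFA.accept M) (begin
  run M (DFA.start M) (u ++ v)               ≡⟨ run-++ M _ u v ⟩
  run M (run M (DFA.start M) u) v            ≡⟨ cong (λ q → run M q v) same ⟩
  run M (run M (DFA.start M) u′) v           ≡⟨ run-++ M _ u′ v ⟨
  run M (DFA.start M) (u′ ++ v)              ∎)

zeros-collide : ∀ {n} (M : DFA n) →
  ∃₂ λ a c → a ≤ c × run M (DFA.start M) (zeros a) ≡ run M (DFA.start M) (zeros (suc c))
zeros-collide {n} M with pigeonhole (n<1+n n) (λ i → run M (DFA.start M) (zeros (toℕ i)))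
... | i , suc j , i<j , same = toℕ i , toℕ j , s≤s⁻¹ i<j , same

HasInfiniteRegularSubset : Language → Set₁
HasInfiniteRegularSubset L = Σ Language λ S → S ⊆ L × Regular S × Infinite S

escapes⇒¬AlmostREG-immune : {L : Language} →
  (∀ {n} (M : DFA n) → Accepted M ⊆ L → HasInfiniteRegularSubset (L ∩ Rejected M)) →
  ¬ AlmostREG-immune L
escapes⇒¬AlmostREG-immune {L} escape (C , D , (_ , C-immune) , (_ , M , D⇔M) , L⇔C∪D) =
  let S , S⊆L∖D , S-regular , S-infinite = escape M D⊆L
  in  C-immune S (λ w → L∖D⊆C w ∘ S⊆L∖D w) S-regular S-infinite
  where
  open Equivalence
  D⊆L : Accepted M ⊆ L
  D⊆L w = from (L⇔C∪D w) ∘ inj₂ ∘ from (D⇔M w)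
  L∖D⊆C : (L ∩ Rejected M) ⊆ C
  L∖D⊆C w (Lw , rejected) with to (L⇔C∪D w) Lw
  ... | inj₁ Cw = Cw
  ... | inj₂ Dw with () ← trans (sym (to (D⇔M w) Dw)) rejected

-- Partial automata

record Automaton (Q : Set) : Set where
  field
    step   : Q → Bool → Maybe Q
    accept : Q → Bool

  steps : Q → Word → Maybe Q
  steps q []      = just q
  steps q (a ∷ w) = step q a >>= λ q′ → steps q′ w

  accepting : Maybe Q → Bool
  accepting = maybe accept false

  Accepts : Q → Language
  Accepts q w = accepting (steps q w) ≡ true

  Accepts-∷ : ∀ {q q′ a} w → step q a ≡ just q′ → Accepts q (a ∷ w) → Accepts q′ w
  Accepts-∷ w eq = subst (λ m → accepting (m >>= λ q → steps q w) ≡ true) eq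

  rejects-∷ : ∀ {q a} w → step q a ≡ nothing → ¬ Accepts q (a ∷ w)
  rejects-∷ w eq acc with () ← subst (λ m → accepting (m >>= λ q → steps q w) ≡ true) eq acc

  halted-accepts-[] : ∀ {q} w → (∀ a → step q a ≡ nothing) → Accepts q w → w ≡ []
  halted-accepts-[] [] halted acc = refl
  halted-accepts-[] (a ∷ w) halted acc = ⊥-elim (rejects-∷ w (halted a) acc)

module _ {Q : Set} {n : ℕ} (enumeration : Q ↔ Fin n) (A : Automaton Q) where
  open Automaton A
  open Inverse enumeration using (to; from; strictlyInverseʳ)

  -- the state 0 is the added dead state
  encode : Maybe Q → Fin (suc n)
  encode = maybe (suc ∘ to) zero

  totalize : Q → DFA (suc n)
  totalize s = record { δ = δ ; start = encode (just s) ; accept = accept′ }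
    where
    δ : Fin (suc n) → Bool → Fin (suc n)
    δ zero    a = zero
    δ (suc i) a = encode (step (from i) a)
    accept′ : Fin (suc n) → Bool
    accept′ zero    = false
    accept′ (suc i) = accept (from i)

  run-dead : ∀ s w → run (totalize s) zero w ≡ zero
  run-dead s []      = refl
  run-dead s (a ∷ w) = run-dead s w

  run-totalize : ∀ s q w → run (totalize s) (encode (just q)) w ≡ encode (steps q w)
  run-totalize s q [] = refl
  run-totalize s q (a ∷ w) rewrite strictlyInverseʳ q with step q a
  ... | nothing = run-dead s w
  ... | just q′ = run-totalize s q′ w

  accepts-totalize : ∀ s w → accepts (totalize s) w ≡ accepting (steps s w)
  accepts-totalize s w with steps s w | run-totalize s s w
  ... | nothing | eq = cong (DFA.accept (totalize s)) eq
  ... | just q  | eq = trans (cong (DFA.accept (totalize s)) eq) (cong accept (strictlyInverseʳ q))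

  regular-by-automaton : {L : Language} (s : Q) → (∀ w → L w ⇔ Accepts s w) → Regular L
  regular-by-automaton s L⇔A = suc n , totalize s , λ w →
    mk⇔ (λ Lw → trans (accepts-totalize s w) (Equivalence.to (L⇔A w) Lw))
        (λ acc → Equivalence.from (L⇔A w) (trans (sym (accepts-totalize s w)) acc))

-- counter r still has to read r copies of x

record Countdown {Q : Set} (A : Automaton Q) (x : Bool) (k : ℕ) : Set where
  open Automaton A
  field
    counter : Fin (suc k) → Q
    tick    : ∀ r → step (counter (suc r)) x ≡ just (counter (inject₁ r))
    stuck   : ∀ r → step (counter (suc r)) (not x) ≡ nothing
    waiting : ∀ r → accept (counter (suc r)) ≡ false

module _ {Q : Set} {A : Automaton Q} {x : Bool} where
  open Automaton A
  open Countdown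

  lower : ∀ {k} → Countdown A x (suc k) → Countdown A x k
  lower C = record
    { counter = counter C ∘ inject₁
    ; tick    = tick C ∘ inject₁
    ; stuck   = stuck C ∘ inject₁
    ; waiting = waiting C ∘ inject₁
    }

  countdown-steps : ∀ {k} (C : Countdown A x k) w →
    steps (counter C (fromℕ k)) (replicate k x ++ w) ≡ steps (counter C zero) w
  countdown-steps {zero}  C w = refl
  countdown-steps {suc k} C w =
    trans (cong (_>>= λ q → steps q (replicate k x ++ w)) (tick C (fromℕ k))) (countdown-steps (lower C) w)

  countdown-accepts : ∀ {k} (C : Countdown A x k) w →
    Accepts (counter C (fromℕ k)) w → ∃ λ v → w ≡ replicate k x ++ v × Accepts (counter C zero) v
  countdown-accepts {zero}  C w acc = w , refl , acc
  countdown-accepts {suc k} C [] acc with () ← trans (sym (waiting C (fromℕ k))) acc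
  countdown-accepts {suc k} C (a ∷ w) acc with a ≟ᵇ x
  ... | yes refl =
    let v , w≡ , acc′ = countdown-accepts (lower C) w (Accepts-∷ w (tick C (fromℕ k)) acc)
    in  v , cong (x ∷_) w≡ , acc′
  ... | no a≢x =
    ⊥-elim (rejects-∷ w (subst (λ b → step _ b ≡ nothing) (sym (¬-not a≢x)) (stuck C (fromℕ k))) acc)

  countdown-accepts-exactly : ∀ {k} (C : Countdown A x k) → accept (counter C zero) ≡ true →
    Accepts (counter C (fromℕ k)) (replicate k x)
  countdown-accepts-exactly {k} C final = begin
    accepting (steps (counter C (fromℕ k)) (replicate k x))
      ≡⟨ cong (accepting ∘ steps (counter C (fromℕ k))) (++-identityʳ (replicate k x)) ⟨
    accepting (steps (counter C (fromℕ k)) (replicate k x ++ []))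
      ≡⟨ cong accepting (countdown-steps C []) ⟩
    accept (counter C zero)
      ≡⟨ final ⟩
    true
      ∎

  countdown-accepts-only : ∀ {k} (C : Countdown A x k) → (∀ a → step (counter C zero) a ≡ nothing) →
    ∀ w → Accepts (counter C (fromℕ k)) w → w ≡ replicate k x
  countdown-accepts-only C halted w acc with countdown-accepts C w acc
  ... | v , refl , acc′ with refl ← halted-accepts-[] v halted acc′ = ++-identityʳ _

-- the block of zeros has length c + 1 because the automata below need it to be nonempty
record ZeroPrefixFamily (L : Language) : Set where
  field
    tail      : ℕ → ℕ → Word
    regular   : ∀ c → Regular (Range (λ m → zeros (suc c) ++ tail c m))
    long      : ∀ c m → m ≤ length (tail c m)
    member    : ∀ c m → L (zeros (suc c) ++ tail c m)
    nonmember : ∀ {a c} m → a ≤ c → ¬ L (zeros a ++ tail c m)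

  Family : ℕ → Language
  Family c = Range (λ m → zeros (suc c) ++ tail c m)

  Family⊆L : ∀ c → Family c ⊆ L
  Family⊆L c w (m , refl) = member c m

  Family-infinite : ∀ c → Infinite (Family c)
  Family-infinite c =
    unbounded⇒infinite _ (λ m → ≤-trans (long c m) (length-++-≤ʳ (tail c m) {zeros (suc c)}))

  Family⊆Rejected : ∀ {n} (M : DFA n) → Accepted M ⊆ L → ∀ {a c} → a ≤ c →
    run M (DFA.start M) (zeros a) ≡ run M (DFA.start M) (zeros (suc c)) → Family c ⊆ Rejected M
  Family⊆Rejected M M⊆L {a} {c} a≤c same w (m , refl) = begin
    accepts M (zeros (suc c) ++ tail c m)
      ≡⟨ accepts-++-cong M (zeros a) (zeros (suc c)) (tail c m) same ⟨
    accepts M (zeros a ++ tail c m)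
      ≡⟨ ¬-not (nonmember m a≤c ∘ M⊆L _) ⟩
    false
      ∎

  levelable : REG-levelable L
  levelable = infinite-⊆ (Family⊆L 0) (Family-infinite 0) , escapes⇒¬AlmostREG-immune escape
    where
    escape : ∀ {n} (M : DFA n) → Accepted M ⊆ L → HasInfiniteRegularSubset (L ∩ Rejected M)
    escape M M⊆L with a , c , a≤c , same ← zeros-collide M =
      Family c , (λ w Fw → Family⊆L c w Fw , Family⊆Rejected M M⊆L a≤c same w Fw) ,
      regular c , Family-infinite c

-- Equal

count-++ : ∀ x u v → count x (u ++ v) ≡ count x u + count x v
count-++ x [] v = refl
count-++ true  (true  ∷ u) v = cong suc (count-++ true u v)
count-++ true  (false ∷ u) v = count-++ true u v
count-++ false (false ∷ u) v = cong suc (count-++ false u v)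
count-++ false (true  ∷ u) v = count-++ false u v

count-replicate : ∀ x k → count x (replicate k x) ≡ k
count-replicate x zero = refl
count-replicate true  (suc k) = cong suc (count-replicate true k)
count-replicate false (suc k) = cong suc (count-replicate false k)

count-replicate-not : ∀ x k → count x (replicate k (not x)) ≡ 0
count-replicate-not x zero = refl
count-replicate-not true  (suc k) = count-replicate-not true k
count-replicate-not false (suc k) = count-replicate-not false k

alternating : ℕ → Word
alternating zero = []
alternating (suc m) = false ∷ true ∷ alternating m

count-alternating : ∀ x m → count x (alternating m) ≡ m
count-alternating x zero = refl
count-alternating true  (suc m) = cong suc (count-alternating true m)
count-alternating false (suc m) = cong suc (count-alternating false m)

length-alternating : ∀ m → m ≤ length (alternating m)
length-alternating zero = z≤n
length-alternating (suc m) = s≤s (m≤n⇒m≤1+n (length-alternating m))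

count-zeros-alternating-ones : ∀ x a m b →
  count x (zeros a ++ alternating m ++ ones b) ≡ count x (zeros a) + (m + count x (ones b))
count-zeros-alternating-ones x a m b = begin
  count x (zeros a ++ alternating m ++ ones b)
    ≡⟨ count-++ x (zeros a) _ ⟩
  count x (zeros a) + count x (alternating m ++ ones b)
    ≡⟨ cong (count x (zeros a) +_) (count-++ x (alternating m) _) ⟩
  count x (zeros a) + (count x (alternating m) + count x (ones b))
    ≡⟨ cong (λ k → count x (zeros a) + (k + count x (ones b))) (count-alternating x m) ⟩
  count x (zeros a) + (m + count x (ones b))
    ∎

Equal-zeros-alternating-ones : ∀ a m b → Equal (zeros a ++ alternating m ++ ones b) ⇔ (a ≡ b)
Equal-zeros-alternating-ones a m b = mk⇔
  (λ eq → +-cancelʳ-≡ m a b (trans (sym zeros-count) (trans eq (trans ones-count (+-comm m b)))))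
  (λ { refl → trans zeros-count (trans (+-comm a m) (sym ones-count)) })
  where
  zeros-count : count false (zeros a ++ alternating m ++ ones b) ≡ a + m
  zeros-count = trans (count-zeros-alternating-ones false a m b)
    (trans (cong₂ (λ i j → i + (m + j)) (count-replicate false a) (count-replicate-not false b))
           (cong (a +_) (+-identityʳ m)))
  ones-count : count true (zeros a ++ alternating m ++ ones b) ≡ m + b
  ones-count = trans (count-zeros-alternating-ones true a m b)
    (cong₂ (λ i j → i + (m + j)) (count-replicate-not true a) (count-replicate true b))

module EqualAutomaton (c : ℕ) where
  State : Set
  State = Fin (suc (suc c)) ⊎ Fin (suc c) ⊎ Fin 1

  pattern prefix r = inj₁ r
  pattern suffix r = inj₂ (inj₁ r)
  pattern expect-one = inj₂ (inj₂ zero)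

  -- prefix zero doubles as the hub of the loop (01)*
  step : State → Bool → Maybe State
  step (prefix (suc r)) false = just (prefix (inject₁ r))
  step (prefix zero)    false = just expect-one
  step expect-one       true  = just (prefix zero)
  step (prefix zero)    true  = just (suffix (fromℕ c))
  step (suffix (suc r)) true  = just (suffix (inject₁ r))
  step _                _     = nothing

  accept : State → Bool
  accept (suffix zero) = true
  accept _             = false

  automaton : Automaton State
  automaton = record { step = step ; accept = accept }
  open Automaton automaton using (steps; Accepts)

  enumeration : State ↔ Fin (suc (suc c) + (suc c + 1))
  enumeration = ↔-sym (↔-trans +↔⊎ (↔-refl ⊎-↔ +↔⊎))

  prefix-counter : Countdown automaton false (suc c)
  prefix-counter = record
    { counter = prefix ; tick = λ _ → refl ; stuck = λ _ → refl ; waiting = λ _ → refl }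

  suffix-counter : Countdown automaton true c
  suffix-counter = record
    { counter = suffix ; tick = λ _ → refl ; stuck = λ _ → refl ; waiting = λ _ → refl }

  loop-steps : ∀ m w → steps (prefix zero) (alternating m ++ w) ≡ steps (prefix zero) w
  loop-steps zero    w = refl
  loop-steps (suc m) w = loop-steps m w

  loop-accepts : ∀ w → Accepts (prefix zero) w → ∃ λ m → w ≡ alternating m ++ ones (suc c)
  loop-accepts (false ∷ true ∷ w) acc with m , refl ← loop-accepts w acc = suc m , refl
  loop-accepts (true ∷ w) acc =
    0 , cong (true ∷_) (countdown-accepts-only suffix-counter (λ _ → refl) w acc)
  loop-accepts [] ()
  loop-accepts (false ∷ []) ()
  loop-accepts (false ∷ false ∷ w) ()

  family : ℕ → Word
  family m = zeros (suc c) ++ alternating m ++ ones (suc c)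

  family⇔Accepts : ∀ w → Range family w ⇔ Accepts (prefix (fromℕ (suc c))) w
  family⇔Accepts w = mk⇔ complete sound
    where
    complete : Range family w → Accepts (prefix (fromℕ (suc c))) w
    complete (m , refl) = trans
      (cong (Automaton.accepting automaton)
            (trans (countdown-steps prefix-counter _) (loop-steps m (ones (suc c)))))
      (countdown-accepts-exactly suffix-counter refl)
    sound : Accepts (prefix (fromℕ (suc c))) w → Range family w
    sound acc with v , refl , acc′ ← countdown-accepts prefix-counter w acc
              with m , refl ← loop-accepts v acc′ = m , refl

equalFamily : ZeroPrefixFamily Equal
equalFamily = record
  { tail      = λ c m → alternating m ++ ones (suc c)
  ; regular   = λ c → let open EqualAutomaton c in
                regular-by-automaton enumeration automaton (prefix (fromℕ (suc c))) family⇔Accepts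
  ; long      = λ c m → ≤-trans (length-alternating m) (length-++-≤ˡ (alternating m))
  ; member    = λ c m → Equivalence.from (Equal-zeros-alternating-ones (suc c) m (suc c)) refl
  ; nonmember = λ m a≤c → <⇒≢ (s≤s a≤c) ∘ Equivalence.to (Equal-zeros-alternating-ones _ m _)
  }

-- Pal

leadingZeros : Word → ℕ
leadingZeros (false ∷ w) = suc (leadingZeros w)
leadingZeros _ = zero

leadingZeros-zeros-++ : ∀ a w → leadingZeros (zeros a ++ true ∷ w) ≡ a
leadingZeros-zeros-++ zero    w = refl
leadingZeros-zeros-++ (suc a) w = cong suc (leadingZeros-zeros-++ a w)

Pal⇒reverse≡ : ∀ {w} → Pal w → reverse w ≡ w
Pal⇒reverse≡ (u , refl) = begin
  reverse (u ++ reverse u)            ≡⟨ reverse-++ u (reverse u) ⟩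
  reverse (reverse u) ++ reverse u    ≡⟨ cong (_++ reverse u) (reverse-involutive u) ⟩
  u ++ reverse u                      ∎

reverse-zeros-ones-zeros : ∀ a k b → reverse (zeros a ++ ones k ++ zeros b) ≡ zeros b ++ ones k ++ zeros a
reverse-zeros-ones-zeros a k b = begin
  reverse (zeros a ++ ones k ++ zeros b)
    ≡⟨ reverse-++ (zeros a) _ ⟩
  reverse (ones k ++ zeros b) ++ reverse (zeros a)
    ≡⟨ cong (_++ reverse (zeros a)) (reverse-++ (ones k) _) ⟩
  (reverse (zeros b) ++ reverse (ones k)) ++ reverse (zeros a)
    ≡⟨ ++-assoc (reverse (zeros b)) _ _ ⟩
  reverse (zeros b) ++ reverse (ones k) ++ reverse (zeros a)
    ≡⟨ cong₂ (λ u v → u ++ v ++ reverse (zeros a)) (reverse-replicate b false) (reverse-replicate k true) ⟩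
  zeros b ++ ones k ++ reverse (zeros a)
    ≡⟨ cong (λ u → zeros b ++ ones k ++ u) (reverse-replicate a false) ⟩
  zeros b ++ ones k ++ zeros a
    ∎

Pal-zeros-ones-zeros : ∀ a k b → Pal (zeros a ++ ones (suc k) ++ zeros b) → a ≡ b
Pal-zeros-ones-zeros a k b pal = begin
  a
    ≡⟨ leadingZeros-zeros-++ a _ ⟨
  leadingZeros (zeros a ++ ones (suc k) ++ zeros b)
    ≡⟨ cong leadingZeros (Pal⇒reverse≡ pal) ⟨
  leadingZeros (reverse (zeros a ++ ones (suc k) ++ zeros b))
    ≡⟨ cong leadingZeros (reverse-zeros-ones-zeros a (suc k) b) ⟩
  leadingZeros (zeros b ++ ones (suc k) ++ zeros a)
    ≡⟨ leadingZeros-zeros-++ b _ ⟩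
  b
    ∎

Pal-zeros-ones-ones-zeros : ∀ b k → Pal (zeros b ++ ones (k + k) ++ zeros b)
Pal-zeros-ones-ones-zeros b k = zeros b ++ ones k , (begin
  zeros b ++ ones (k + k) ++ zeros b
    ≡⟨ cong (λ u → zeros b ++ u ++ zeros b) (replicate-+ k k true) ⟩
  zeros b ++ (ones k ++ ones k) ++ zeros b
    ≡⟨ cong (zeros b ++_) (++-assoc (ones k) _ _) ⟩
  zeros b ++ ones k ++ ones k ++ zeros b
    ≡⟨ ++-assoc (zeros b) _ _ ⟨
  (zeros b ++ ones k) ++ ones k ++ zeros b
    ≡⟨ cong ((zeros b ++ ones k) ++_) (reverse-zeros-ones-zeros b k 0) ⟨
  (zeros b ++ ones k) ++ reverse (zeros b ++ ones k ++ [])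
    ≡⟨ cong (λ u → (zeros b ++ ones k) ++ reverse (zeros b ++ u)) (++-identityʳ (ones k)) ⟩
  (zeros b ++ ones k) ++ reverse (zeros b ++ ones k)
    ∎)

ones-suc+suc : ∀ m w → ones (suc m + suc m) ++ w ≡ true ∷ true ∷ ones (m + m) ++ w
ones-suc+suc m w = cong (λ k → true ∷ ones k ++ w) (+-suc m m)

module PalAutomaton (c : ℕ) where
  State : Set
  State = Fin (suc (suc c)) ⊎ Fin (suc c) ⊎ Fin 2

  pattern prefix r = inj₁ r
  pattern suffix r = inj₂ (inj₁ r)
  pattern odd      = inj₂ (inj₂ zero)
  pattern even     = inj₂ (inj₂ (suc zero))

  step : State → Bool → Maybe State
  step (prefix (suc r)) false = just (prefix (inject₁ r))
  step (prefix zero)    true  = just odd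
  step odd              true  = just even
  step even             true  = just odd
  step even             false = just (suffix (fromℕ c))
  step (suffix (suc r)) false = just (suffix (inject₁ r))
  step _                _     = nothing

  accept : State → Bool
  accept (suffix zero) = true
  accept _             = false

  automaton : Automaton State
  automaton = record { step = step ; accept = accept }
  open Automaton automaton using (steps; Accepts)

  enumeration : State ↔ Fin (suc (suc c) + (suc c + 2))
  enumeration = ↔-sym (↔-trans +↔⊎ (↔-refl ⊎-↔ +↔⊎))

  prefix-counter : Countdown automaton false (suc c)
  prefix-counter = record
    { counter = prefix ; tick = λ _ → refl ; stuck = λ _ → refl ; waiting = λ _ → refl }

  suffix-counter : Countdown automaton false c
  suffix-counter = record
    { counter = suffix ; tick = λ _ → refl ; stuck = λ _ → refl ; waiting = λ _ → refl }

  even-steps : ∀ m w → steps even (ones (m + m) ++ w) ≡ steps even w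
  even-steps zero    w = refl
  even-steps (suc m) w = trans (cong (steps even) (ones-suc+suc m w)) (even-steps m w)

  even-accepts : ∀ w → Accepts even w → ∃ λ m → w ≡ ones (m + m) ++ zeros (suc c)
  even-accepts (false ∷ w) acc =
    0 , cong (false ∷_) (countdown-accepts-only suffix-counter (λ _ → refl) w acc)
  even-accepts (true ∷ true ∷ w) acc with m , refl ← even-accepts w acc = suc m , sym (ones-suc+suc m _)
  even-accepts [] ()
  even-accepts (true ∷ []) ()
  even-accepts (true ∷ false ∷ w) ()

  family : ℕ → Word
  family m = zeros (suc c) ++ ones (suc m + suc m) ++ zeros (suc c)

  family⇔Accepts : ∀ w → Range family w ⇔ Accepts (prefix (fromℕ (suc c))) w
  family⇔Accepts w = mk⇔ complete sound
    where
    complete : Range family w → Accepts (prefix (fromℕ (suc c))) w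
    complete (m , refl) = trans
      (cong (Automaton.accepting automaton) (begin
        steps (prefix (fromℕ (suc c))) (zeros (suc c) ++ ones (suc m + suc m) ++ zeros (suc c))
          ≡⟨ countdown-steps prefix-counter _ ⟩
        steps (prefix zero) (ones (suc m + suc m) ++ zeros (suc c))
          ≡⟨ cong (steps (prefix zero)) (ones-suc+suc m _) ⟩
        steps even (ones (m + m) ++ zeros (suc c))
          ≡⟨ even-steps m _ ⟩
        steps even (zeros (suc c))
          ∎))
      (countdown-accepts-exactly suffix-counter refl)
    sound : Accepts (prefix (fromℕ (suc c))) w → Range family w
    sound acc with countdown-accepts prefix-counter w acc
    ... | true ∷ true ∷ v , refl , acc′ with m , refl ← even-accepts v acc′ =
      m , cong (zeros (suc c) ++_) (sym (ones-suc+suc m _))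
    ... | [] , _ , ()
    ... | true ∷ [] , _ , ()
    ... | true ∷ false ∷ _ , _ , ()
    ... | false ∷ _ , _ , ()

palFamily : ZeroPrefixFamily Pal
palFamily = record
  { tail      = λ c m → ones (suc m + suc m) ++ zeros (suc c)
  ; regular   = λ c → let open PalAutomaton c in
                regular-by-automaton enumeration automaton (prefix (fromℕ (suc c))) family⇔Accepts
  ; long      = λ c m → ≤-trans (≤-trans (n≤1+n m) (m≤m+n (suc m) (suc m)))
                                  (length-replicate-++ (suc m + suc m) true (zeros (suc c)))
  ; member    = λ c m → Pal-zeros-ones-ones-zeros (suc c) (suc m)
  ; nonmember = λ m a≤c → <⇒≢ (s≤s a≤c) ∘ Pal-zeros-ones-zeros _ _ _
  }

proposition4p4 : REG-levelable Equal × REG-levelable Pal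
proposition4p4 = ZeroPrefixFamily.levelable equalFamily , ZeroPrefixFamily.levelable palFamily
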